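{- Let $\ell \ge 1$ be an integer, and let $k,w$ be positive integers with \[ w^\ell=\sum_{i=1}^k \left((w+i)^\ell - (w-i)^\ell \right). \] Then, writing $K=k(k+1)$, \[ \ell K +\frac{(\ell-1)(\ell-2)}{12 \ell} - \frac{(\ell-1)^2(\ell-2)^2}{72 \ell^3 K} \;\le\; w \;\le\; \ell K +\frac{(\ell-1)(\ell-2)}{12 \ell}. \]
   Context: The equation is the equation $n^\ell+(n+1)^\ell+\cdots+(n+k)^\ell=(n+k+1)^\ell+\cdots+(n+2k)^\ell$ rewritten in the variable $w=n+k$; equivalently $w^\ell = 2 \sum_{m \text{ odd}} \binom{\ell}{m} w^{\ell-m} \sum_{i=1}^k i^m$. -}

module Defs where

open import Data.Nat as ℕ using (ℕ; zero; suc)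
open import Data.Integer as ℤ using (ℤ; +_)
open import Data.Rational as ℚ using (ℚ; _/_)

sumFrom1 : ℕ → (ℕ → ℤ) → ℤ
sumFrom1 zero    f = + 0
sumFrom1 (suc k) f = sumFrom1 k f ℤ.+ f (suc k)

-- Σ_{i=1}^{k} ((w+i)^ℓ - (w-i)^ℓ), computed in ℤ (w - i may be negative)
diffSum : ℕ → ℕ → ℕ → ℤ
diffSum ℓ k w = sumFrom1 k (λ i → ((+ w ℤ.+ + i) ℤ.^ ℓ) ℤ.- ((+ w ℤ.- + i) ℤ.^ ℓ))

ι : ℤ → ℚ
ι z = z / 1

-- The bounds, for ℓ = suc m ≥ 1 and k = suc j ≥ 1 (so all denominators are
-- nonzero).  For ℓ = 0 or k = 0 the value is irrelevant (excluded by hypotheses).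
-- Numerators are computed in ℤ: (ℓ-1)(ℓ-2) with genuine integer subtraction.

corr1 : ℕ → ℚ
corr1 zero    = ℚ.0ℚ
corr1 (suc m) = ((+ (suc m) ℤ.- + 1) ℤ.* (+ (suc m) ℤ.- + 2)) / (12 ℕ.* suc m)

corr2 : ℕ → ℕ → ℚ
corr2 zero    k       = ℚ.0ℚ
corr2 (suc m) zero    = ℚ.0ℚ
corr2 (suc m) (suc j) =
  (((+ (suc m) ℤ.- + 1) ℤ.^ 2) ℤ.* ((+ (suc m) ℤ.- + 2) ℤ.^ 2))
    / (72 ℕ.* (suc m ℕ.^ 3) ℕ.* (suc j ℕ.* suc (suc j)))

Kof : ℕ → ℕ
Kof k = k ℕ.* (k ℕ.+ 1)

upperBound : ℕ → ℕ → ℚ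
upperBound ℓ k = ι (+ (ℓ ℕ.* Kof k)) ℚ.+ corr1 ℓ

lowerBound : ℕ → ℕ → ℚ
lowerBound ℓ k = upperBound ℓ k ℚ.- corr2 ℓ k

-- Write U ℓ x i = (x+i)^ℓ − (x−i)^ℓ and V ℓ x i = (x+i)^ℓ + (x−i)^ℓ; both are polynomials
-- with non-negative coefficients, given by a joint recurrence in ℓ, so everything happens in ℕ.
-- Truncating the binomial expansion of U gives lower bounds of order one and three in i, and
-- (jointly with V, when 2ℓi ≤ x) an upper bound of order five.  Summing them over 1 ≤ i ≤ k
-- with Faulhaber's formulas for Σ i, Σ i³, Σ i⁵ (all polynomials in K) and using Σ U = w^ℓ:
--   * the first-order bound gives ℓK ≤ w, so w = ℓK + e with e ≥ 0 (and 2ℓi ≤ w for i ≤ k);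
--   * the fifth-order bound is a polynomial inequality forcing 12ℓe ≤ δ  (upper bound);
--   * the third-order bound, combined with 12ℓe ≤ δ, forces the lower bound on e.
module Submission where

open import Defs
open import Data.Nat as ℕ using (ℕ; _≤_)
open import Data.Integer as ℤ using (+_)
open import Data.Rational as ℚ using (ℚ)
open import Data.Product using (_×_)
open import Relation.Binary.PropositionalEquality using (_≡_)

open import Data.Nat using (zero; suc; _<_; _+_; _*_; _∸_; _^_; z≤n; s≤s; _≤?_; NonZero)
open import Data.Nat.Properties
open import Data.Nat.Tactic.RingSolver using (solve-∀)
open import Algebra.Properties.CommutativeSemigroup +-commutativeSemigroup using (interchange)
import Data.Integer.Properties as ℤP
import Data.Integer.Tactic.RingSolver as ℤSolver
import Data.Rational.Properties as ℚP
open import Data.Rational.Unnormalised as ℚᵘ using (mkℚᵘ)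
import Data.Rational.Unnormalised.Properties as ℚᵘP
open import Data.Product using (_,_; proj₁; proj₂)
open import Data.Empty using (⊥; ⊥-elim)
open import Relation.Nullary using (yes; no)
open import Relation.Binary.PropositionalEquality using (refl; sym; trans; cong; cong₂; subst; subst₂; module ≡-Reasoning)

-- U ℓ x i = (x+i)^ℓ − (x−i)^ℓ  and  V ℓ x i = (x+i)^ℓ + (x−i)^ℓ, via the recurrence obtained from
-- (x ± i)^{ℓ+1} = (x ± i)·(x ± i)^ℓ; it shows that both have non-negative coefficients.
mutual
  U : ℕ → ℕ → ℕ → ℕ
  U zero    x i = 0
  U (suc ℓ) x i = x * U ℓ x i + i * V ℓ x i

  V : ℕ → ℕ → ℕ → ℕ
  V zero    x i = 2
  V (suc ℓ) x i = x * V ℓ x i + i * U ℓ x i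

U-V-meaning : ∀ ℓ x i → ((+ x ℤ.+ + i) ℤ.^ ℓ ℤ.- (+ x ℤ.- + i) ℤ.^ ℓ ≡ + U ℓ x i)
                      × ((+ x ℤ.+ + i) ℤ.^ ℓ ℤ.+ (+ x ℤ.- + i) ℤ.^ ℓ ≡ + V ℓ x i)
U-V-meaning zero    x i = refl , refl
U-V-meaning (suc ℓ) x i =
  trans (split-diff (+ x) (+ i) A B) (trans (cong₂ combine diff sum) (combine-pos (U ℓ x i) (V ℓ x i))) ,
  trans (split-sum (+ x) (+ i) A B) (trans (cong₂ combine sum diff) (combine-pos (V ℓ x i) (U ℓ x i)))
  where
  A = (+ x ℤ.+ + i) ℤ.^ ℓ
  B = (+ x ℤ.- + i) ℤ.^ ℓ
  diff = proj₁ (U-V-meaning ℓ x i)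
  sum  = proj₂ (U-V-meaning ℓ x i)
  combine : ℤ.ℤ → ℤ.ℤ → ℤ.ℤ
  combine s t = + x ℤ.* s ℤ.+ + i ℤ.* t
  combine-pos : ∀ u v → combine (+ u) (+ v) ≡ + (x * u + i * v)
  combine-pos u v = sym (trans (ℤP.pos-+ (x * u) (i * v)) (cong₂ ℤ._+_ (ℤP.pos-* x u) (ℤP.pos-* i v)))
  split-diff : ∀ (a b X Y : ℤ.ℤ) → (a ℤ.+ b) ℤ.* X ℤ.- (a ℤ.- b) ℤ.* Y ≡ a ℤ.* (X ℤ.- Y) ℤ.+ b ℤ.* (X ℤ.+ Y)
  split-diff = ℤSolver.solve-∀
  split-sum : ∀ (a b X Y : ℤ.ℤ) → (a ℤ.+ b) ℤ.* X ℤ.+ (a ℤ.- b) ℤ.* Y ≡ a ℤ.* (X ℤ.+ Y) ℤ.+ b ℤ.* (X ℤ.- Y)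
  split-sum = ℤSolver.solve-∀

sumN : ℕ → (ℕ → ℕ) → ℕ
sumN zero    f = 0
sumN (suc k) f = sumN k f + f (suc k)

diffSum-as-sumN : ∀ ℓ k w → diffSum ℓ k w ≡ + sumN k (U ℓ w)
diffSum-as-sumN ℓ zero    w = refl
diffSum-as-sumN ℓ (suc k) w =
  trans (cong₂ ℤ._+_ (diffSum-as-sumN ℓ k w) (proj₁ (U-V-meaning ℓ w (suc k))))
        (sym (ℤP.pos-+ (sumN k (U ℓ w)) _))

pos-^ : ∀ w ℓ → (+ w) ℤ.^ ℓ ≡ + (w ^ ℓ)
pos-^ w zero    = refl
pos-^ w (suc ℓ) = trans (cong (+ w ℤ.*_) (pos-^ w ℓ)) (sym (ℤP.pos-* w (w ^ ℓ)))

Balanced : ℕ → ℕ → ℕ → Set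
Balanced ℓ k w = sumN k (U ℓ w) ≡ w ^ ℓ

balanced-from-ℤ : ∀ ℓ k w → (+ w) ℤ.^ ℓ ≡ diffSum ℓ k w → Balanced ℓ k w
balanced-from-ℤ ℓ k w h = ℤP.+-injective (sym (trans (sym (pos-^ w ℓ)) (trans h (diffSum-as-sumN ℓ k w))))

-- Falling factorial  fall n r = n (n−1) ⋯ (n−r+1), and its Pascal rule, which drives the
-- inductions over ℓ below (the coefficients of the truncated expansions are fall ℓ r).
fall : ℕ → ℕ → ℕ
fall n zero    = 1
fall n (suc r) = fall n r * (n ∸ r)

-- (n − r)(n − r − 1 + 1) = (n − r)²: truncated subtraction is harmless once multiplied by n − r.
∸-step : ∀ n r → (n ∸ r) * suc (n ∸ suc r) ≡ (n ∸ r) * (n ∸ r)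
∸-step zero    zero    = refl
∸-step zero    (suc r) = refl
∸-step (suc n) zero    = refl
∸-step (suc n) (suc r) = ∸-step n r

fall-suc : ∀ n r → fall (suc n) (suc r) ≡ fall n (suc r) + suc r * fall n r
fall-suc n zero    = base n
  where
  base : ∀ n → 1 * (1 + n) ≡ 1 * n + 1 * 1
  base = solve-∀
fall-suc n (suc r) = begin
  fall (suc n) (suc r) * (n ∸ r)              ≡⟨ cong (_* d) (fall-suc n r) ⟩
  (F * d + suc r * F) * d                     ≡⟨ expand F d r ⟩
  F * (d * d) + suc r * (F * d)               ≡⟨ cong (λ t → F * t + suc r * (F * d)) (sym (∸-step n r)) ⟩
  F * (d * suc (n ∸ suc r)) + suc r * (F * d) ≡⟨ regroup F d (n ∸ suc r) r ⟩
  F * d * (n ∸ suc r) + suc (suc r) * (F * d) ∎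
  where
  open ≡-Reasoning
  F = fall n r
  d = n ∸ r
  expand : ∀ F d r → (F * d + (1 + r) * F) * d ≡ F * (d * d) + (1 + r) * (F * d)
  expand = solve-∀
  regroup : ∀ F d d' r → F * (d * (1 + d')) + (1 + r) * (F * d) ≡ F * d * d' + (2 + r) * (F * d)
  regroup = solve-∀

V-zeroth : ∀ ℓ x i → 2 * x ^ ℓ ≤ V ℓ x i
V-zeroth zero    x i = ≤-refl
V-zeroth (suc ℓ) x i = begin
  2 * (x * x ^ ℓ)               ≡⟨ swap x (x ^ ℓ) ⟩
  x * (2 * x ^ ℓ)               ≤⟨ *-monoʳ-≤ x (V-zeroth ℓ x i) ⟩
  x * V ℓ x i                   ≤⟨ m≤m+n _ _ ⟩
  x * V ℓ x i + i * U ℓ x i     ∎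
  where
  open ≤-Reasoning
  swap : ∀ x X → 2 * (x * X) ≡ x * (2 * X)
  swap = solve-∀

U-first : ∀ ℓ x i → 2 * ℓ * i * x ^ ℓ ≤ x * U ℓ x i
U-first zero    x i = z≤n
U-first (suc ℓ) x i = begin
  2 * (1 + ℓ) * i * (x * X)                 ≡⟨ split ℓ i x X ⟩
  x * (2 * ℓ * i * X) + x * i * (2 * X)     ≤⟨ +-mono-≤ (*-monoʳ-≤ x (U-first ℓ x i)) (*-monoʳ-≤ (x * i) (V-zeroth ℓ x i)) ⟩
  x * (x * U ℓ x i) + x * i * V ℓ x i       ≡⟨ join x (U ℓ x i) i (V ℓ x i) ⟩
  x * (x * U ℓ x i + i * V ℓ x i)           ∎
  where
  open ≤-Reasoning
  X = x ^ ℓ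
  split : ∀ ℓ i x X → 2 * (1 + ℓ) * i * (x * X) ≡ x * (2 * ℓ * i * X) + x * i * (2 * X)
  split = solve-∀
  join : ∀ x u i v → x * (x * u) + x * i * v ≡ x * (x * u + i * v)
  join = solve-∀

V-second : ∀ ℓ x i → x ^ ℓ * (2 * (x * x) + fall ℓ 2 * (i * i)) ≤ x * x * V ℓ x i
V-second zero    x i = ≤-reflexive (base x)
  where
  base : ∀ x → 1 * (2 * (x * x) + 0) ≡ x * x * 2
  base = solve-∀
V-second (suc ℓ) x i = begin
  x * X * (2 * (x * x) + fall (suc ℓ) 2 * (i * i))
    ≡⟨ cong (λ t → x * X * (2 * (x * x) + t * (i * i))) (fall-suc ℓ 1) ⟩
  x * X * (2 * (x * x) + (fall ℓ 2 + 2 * fall ℓ 1) * (i * i))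
    ≡⟨ split x X (fall ℓ 2) ℓ i ⟩
  x * (X * (2 * (x * x) + fall ℓ 2 * (i * i))) + i * x * (2 * ℓ * i * X)
    ≤⟨ +-mono-≤ (*-monoʳ-≤ x (V-second ℓ x i)) (*-monoʳ-≤ (i * x) (U-first ℓ x i)) ⟩
  x * (x * x * V ℓ x i) + i * x * (x * U ℓ x i)
    ≡⟨ join x (V ℓ x i) i (U ℓ x i) ⟩
  x * x * (x * V ℓ x i + i * U ℓ x i) ∎
  where
  open ≤-Reasoning
  X = x ^ ℓ
  split : ∀ x X f l i → x * X * (2 * (x * x) + (f + 2 * (1 * l)) * (i * i))
                      ≡ x * (X * (2 * (x * x) + f * (i * i))) + i * x * (2 * l * i * X)
  split = solve-∀
  join : ∀ x v i u → x * (x * x * v) + i * x * (x * u) ≡ x * x * (x * v + i * u)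
  join = solve-∀

U-third : ∀ ℓ x i → x ^ ℓ * (6 * ℓ * (x * x) * i + fall ℓ 3 * (i * i * i)) ≤ 3 * (x * x * x) * U ℓ x i
U-third zero    x i = z≤n
U-third (suc ℓ) x i = begin
  x * X * (6 * (1 + ℓ) * (x * x) * i + fall (suc ℓ) 3 * (i * i * i))
    ≡⟨ cong (λ t → x * X * (6 * (1 + ℓ) * (x * x) * i + t * (i * i * i))) (fall-suc ℓ 2) ⟩
  x * X * (6 * (1 + ℓ) * (x * x) * i + (fall ℓ 3 + 3 * fall ℓ 2) * (i * i * i))
    ≡⟨ split x X ℓ i (fall ℓ 3) (fall ℓ 2) ⟩
  x * (X * (6 * ℓ * (x * x) * i + fall ℓ 3 * (i * i * i))) + 3 * i * x * (X * (2 * (x * x) + fall ℓ 2 * (i * i)))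
    ≤⟨ +-mono-≤ (*-monoʳ-≤ x (U-third ℓ x i)) (*-monoʳ-≤ (3 * i * x) (V-second ℓ x i)) ⟩
  x * (3 * (x * x * x) * U ℓ x i) + 3 * i * x * (x * x * V ℓ x i)
    ≡⟨ join x (U ℓ x i) i (V ℓ x i) ⟩
  3 * (x * x * x) * (x * U ℓ x i + i * V ℓ x i) ∎
  where
  open ≤-Reasoning
  X = x ^ ℓ
  split : ∀ x X l i f g → x * X * (6 * (1 + l) * (x * x) * i + (f + 3 * g) * (i * i * i))
                        ≡ x * (X * (6 * l * (x * x) * i + f * (i * i * i))) + 3 * i * x * (X * (2 * (x * x) + g * (i * i)))
  split = solve-∀
  join : ∀ x u i v → x * (3 * (x * x * x) * u) + 3 * i * x * (x * x * v) ≡ 3 * (x * x * x) * (x * u + i * v)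
  join = solve-∀

-- Majorants of 150x⁵·U and 10x⁴·V, i.e. of U and V truncated after the i⁵ resp. i⁴ term
-- (coefficients 2·C(ℓ,1), 2·C(ℓ,3), 2·C(ℓ,5) and 2, 2·C(ℓ,2), 2·C(ℓ,4), scaled).
U-majorant : ℕ → ℕ → ℕ → ℕ
U-majorant ℓ x i = 300 * ℓ * (x * x * x * x) * i + 50 * fall ℓ 3 * (x * x) * (i * i * i) + 3 * fall ℓ 5 * (i * i * i * i * i)

V-majorant : ℕ → ℕ → ℕ → ℕ
V-majorant ℓ x i = 20 * (x * x * x * x) + 10 * fall ℓ 2 * (x * x) * (i * i) + fall ℓ 4 * (i * i * i * i)

-- When 2ℓi ≤ x the terms of the expansion decrease fast enough that the discarded i⁶ term of V
-- is absorbed:  3·fall ℓ 5·i² ≤ 10·fall ℓ 3·x².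
absorb-sixth : ∀ ℓ x i → 2 * ℓ * i ≤ x → 3 * fall ℓ 5 * (i * i) ≤ 10 * fall ℓ 3 * (x * x)
absorb-sixth ℓ x i small = begin
  3 * fall ℓ 5 * (i * i)                   ≡⟨ regroup (fall ℓ 3) (ℓ ∸ 3) (ℓ ∸ 4) i ⟩
  f * (3 * ((ℓ ∸ 3) * (ℓ ∸ 4) * (i * i)))  ≤⟨ *-monoʳ-≤ f (*-monoʳ-≤ 3 (*-monoˡ-≤ (i * i) (*-mono-≤ (m∸n≤m ℓ 3) (m∸n≤m ℓ 4)))) ⟩
  f * (3 * (ℓ * ℓ * (i * i)))              ≤⟨ *-monoʳ-≤ f (*-monoˡ-≤ (ℓ * ℓ * (i * i)) (n≤1+n 3)) ⟩
  f * (4 * (ℓ * ℓ * (i * i)))              ≡⟨ square f ℓ i ⟩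
  f * ((2 * ℓ * i) * (2 * ℓ * i))          ≤⟨ *-monoʳ-≤ f (*-mono-≤ small small) ⟩
  f * (x * x)                              ≤⟨ m≤n*m (f * (x * x)) 10 ⟩
  10 * (f * (x * x))                       ≡⟨ sym (*-assoc 10 f (x * x)) ⟩
  10 * f * (x * x)                         ∎
  where
  open ≤-Reasoning
  f = fall ℓ 3
  regroup : ∀ f a b i → 3 * (f * a * b) * (i * i) ≡ f * (3 * (a * b * (i * i)))
  regroup = solve-∀
  square : ∀ f l i → f * (4 * (l * l * (i * i))) ≡ f * ((2 * l * i) * (2 * l * i))
  square = solve-∀

-- Fifth-order upper bound for U, proved jointly with the fourth-order bound for V
-- (each recurrence step uses both).  Valid in the range 2ℓi ≤ x.
U-V-upper : ∀ ℓ x i → 2 * ℓ * i ≤ x →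
            (150 * (x * x * x * x * x) * U ℓ x i ≤ x ^ ℓ * U-majorant ℓ x i)
          × (10 * (x * x * x * x) * V ℓ x i ≤ x ^ ℓ * V-majorant ℓ x i)
U-V-upper zero x i _ = ≤-trans (≤-reflexive (*-zeroʳ (150 * (x * x * x * x * x)))) z≤n , ≤-reflexive (base x)
  where
  base : ∀ x → 10 * (x * x * x * x) * 2 ≡ 1 * (20 * (x * x * x * x) + 0 + 0)
  base = solve-∀
U-V-upper (suc ℓ) zero    i _     = z≤n , z≤n
U-V-upper (suc ℓ) x@(suc _) i small = U-step , V-step
  where
  open ≤-Reasoning
  small-ℓ : 2 * ℓ * i ≤ x
  small-ℓ = ≤-trans (*-monoˡ-≤ i (*-monoʳ-≤ 2 (n≤1+n ℓ))) small
  IH = U-V-upper ℓ x i small-ℓ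
  X = x ^ ℓ
  u = U ℓ x i
  v = V ℓ x i
  U-step : 150 * (x * x * x * x * x) * (x * u + i * v) ≤ x * X * U-majorant (suc ℓ) x i
  U-step = begin
    150 * (x * x * x * x * x) * (x * u + i * v)
      ≡⟨ split x u i v ⟩
    x * (150 * (x * x * x * x * x) * u) + 15 * i * x * (10 * (x * x * x * x) * v)
      ≤⟨ +-mono-≤ (*-monoʳ-≤ x (proj₁ IH)) (*-monoʳ-≤ (15 * i * x) (proj₂ IH)) ⟩
    x * (X * U-majorant ℓ x i) + 15 * i * x * (X * V-majorant ℓ x i)
      ≡⟨ join x X ℓ i (fall ℓ 2) (fall ℓ 3) (fall ℓ 4) (fall ℓ 5) ⟩
    x * X * (300 * (1 + ℓ) * (x * x * x * x) * i + 50 * (fall ℓ 3 + 3 * fall ℓ 2) * (x * x) * (i * i * i)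
             + 3 * (fall ℓ 5 + 5 * fall ℓ 4) * (i * i * i * i * i))
      ≡⟨ cong₂ (λ s t → x * X * (300 * (1 + ℓ) * (x * x * x * x) * i + 50 * s * (x * x) * (i * i * i) + 3 * t * (i * i * i * i * i)))
               (sym (fall-suc ℓ 2)) (sym (fall-suc ℓ 4)) ⟩
    x * X * U-majorant (suc ℓ) x i ∎
    where
    split : ∀ x u i v → 150 * (x * x * x * x * x) * (x * u + i * v)
                      ≡ x * (150 * (x * x * x * x * x) * u) + 15 * i * x * (10 * (x * x * x * x) * v)
    split = solve-∀
    join : ∀ x X l i g2 g3 g4 g5 →
           x * (X * (300 * l * (x * x * x * x) * i + 50 * g3 * (x * x) * (i * i * i) + 3 * g5 * (i * i * i * i * i)))
             + 15 * i * x * (X * (20 * (x * x * x * x) + 10 * g2 * (x * x) * (i * i) + g4 * (i * i * i * i)))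
           ≡ x * X * (300 * (1 + l) * (x * x * x * x) * i + 50 * (g3 + 3 * g2) * (x * x) * (i * i * i)
                      + 3 * (g5 + 5 * g4) * (i * i * i * i * i))
    join = solve-∀
  -- The V-step produces an i⁶ term 3·fall ℓ 5·i⁶ that has no place in V-majorant; it is traded
  -- for an x²i⁴ term by absorb-sixth.  Everything is multiplied by 15x to keep coefficients integral.
  R : ℕ
  R = 300 * (x * x * x * x * x * x) + 150 * fall ℓ 2 * (i * i) * (x * x * x * x) + 15 * fall ℓ 4 * (i * i * i * i) * (x * x)
      + 300 * ℓ * (i * i) * (x * x * x * x) + 50 * fall ℓ 3 * (i * i * i * i) * (x * x)
  V-step-scaled : 15 * x * (10 * (x * x * x * x) * (x * v + i * u)) ≤ 15 * x * (x * X * V-majorant (suc ℓ) x i)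
  V-step-scaled = begin
    15 * x * (10 * (x * x * x * x) * (x * v + i * u))
      ≡⟨ split x v i u ⟩
    15 * x * x * (10 * (x * x * x * x) * v) + i * (150 * (x * x * x * x * x) * u)
      ≤⟨ +-mono-≤ (*-monoʳ-≤ (15 * x * x) (proj₂ IH)) (*-monoʳ-≤ i (proj₁ IH)) ⟩
    15 * x * x * (X * V-majorant ℓ x i) + i * (X * U-majorant ℓ x i)
      ≡⟨ expand x X ℓ i (fall ℓ 2) (fall ℓ 3) (fall ℓ 4) (fall ℓ 5) ⟩
    X * (R + (i * i * i * i) * (3 * fall ℓ 5 * (i * i)))
      ≤⟨ *-monoʳ-≤ X (+-monoʳ-≤ R (*-monoʳ-≤ (i * i * i * i) (absorb-sixth ℓ x i small-ℓ))) ⟩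
    X * (R + (i * i * i * i) * (10 * fall ℓ 3 * (x * x)))
      ≡⟨ join x X ℓ i (fall ℓ 2) (fall ℓ 3) (fall ℓ 4) ⟩
    15 * x * (x * X * (20 * (x * x * x * x) + 10 * (fall ℓ 2 + 2 * fall ℓ 1) * (x * x) * (i * i) + (fall ℓ 4 + 4 * fall ℓ 3) * (i * i * i * i)))
      ≡⟨ cong₂ (λ s t → 15 * x * (x * X * (20 * (x * x * x * x) + 10 * s * (x * x) * (i * i) + t * (i * i * i * i))))
               (sym (fall-suc ℓ 1)) (sym (fall-suc ℓ 3)) ⟩
    15 * x * (x * X * V-majorant (suc ℓ) x i) ∎
    where
    split : ∀ x v i u → 15 * x * (10 * (x * x * x * x) * (x * v + i * u))
                      ≡ 15 * x * x * (10 * (x * x * x * x) * v) + i * (150 * (x * x * x * x * x) * u)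
    split = solve-∀
    expand : ∀ x X l i g2 g3 g4 g5 →
             15 * x * x * (X * (20 * (x * x * x * x) + 10 * g2 * (x * x) * (i * i) + g4 * (i * i * i * i)))
               + i * (X * (300 * l * (x * x * x * x) * i + 50 * g3 * (x * x) * (i * i * i) + 3 * g5 * (i * i * i * i * i)))
             ≡ X * ((300 * (x * x * x * x * x * x) + 150 * g2 * (i * i) * (x * x * x * x) + 15 * g4 * (i * i * i * i) * (x * x)
                     + 300 * l * (i * i) * (x * x * x * x) + 50 * g3 * (i * i * i * i) * (x * x))
                    + (i * i * i * i) * (3 * g5 * (i * i)))
    expand = solve-∀
    join : ∀ x X l i g2 g3 g4 →
           X * ((300 * (x * x * x * x * x * x) + 150 * g2 * (i * i) * (x * x * x * x) + 15 * g4 * (i * i * i * i) * (x * x)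
                 + 300 * l * (i * i) * (x * x * x * x) + 50 * g3 * (i * i * i * i) * (x * x))
                + (i * i * i * i) * (10 * g3 * (x * x)))
           ≡ 15 * x * (x * X * (20 * (x * x * x * x) + 10 * (g2 + 2 * (1 * l)) * (x * x) * (i * i) + (g4 + 4 * g3) * (i * i * i * i)))
    join = solve-∀
  V-step : 10 * (x * x * x * x) * (x * v + i * u) ≤ x * X * V-majorant (suc ℓ) x i
  V-step = *-cancelˡ-≤ (15 * x) V-step-scaled

sum-mono : ∀ k (f g : ℕ → ℕ) → (∀ i → i ≤ k → f i ≤ g i) → sumN k f ≤ sumN k g
sum-mono zero    f g h = z≤n
sum-mono (suc k) f g h = +-mono-≤ (sum-mono k f g (λ i i≤k → h i (m≤n⇒m≤1+n i≤k))) (h (suc k) ≤-refl)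

sum-scale : ∀ k c (f : ℕ → ℕ) → sumN k (λ i → c * f i) ≡ c * sumN k f
sum-scale zero    c f = sym (*-zeroʳ c)
sum-scale (suc k) c f =
  trans (cong (_+ c * f (suc k)) (sum-scale k c f)) (sym (*-distribˡ-+ c (sumN k f) (f (suc k))))

sum-+ : ∀ k (f g : ℕ → ℕ) → sumN k (λ i → f i + g i) ≡ sumN k f + sumN k g
sum-+ zero    f g = refl
sum-+ (suc k) f g =
  trans (cong (_+ (f (suc k) + g (suc k))) (sum-+ k f g)) (interchange (sumN k f) (sumN k g) (f (suc k)) (g (suc k)))

S1 S3 S5 : ℕ → ℕ
S1 k = sumN k (λ i → i)
S3 k = sumN k (λ i → i * i * i)
S5 k = sumN k (λ i → i * i * i * i * i)

S1-closed : ∀ k → 2 * S1 k ≡ Kof k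
S1-closed zero    = refl
S1-closed (suc k) = trans (*-distribˡ-+ 2 (S1 k) (suc k)) (trans (cong (_+ 2 * suc k) (S1-closed k)) (step k))
  where
  step : ∀ k → k * (k + 1) + 2 * (1 + k) ≡ (1 + k) * ((1 + k) + 1)
  step = solve-∀

S3-closed : ∀ k → 4 * S3 k ≡ Kof k * Kof k
S3-closed zero    = refl
S3-closed (suc k) =
  trans (*-distribˡ-+ 4 (S3 k) _) (trans (cong (_+ 4 * (suc k * suc k * suc k)) (S3-closed k)) (step k))
  where
  step : ∀ k → k * (k + 1) * (k * (k + 1)) + 4 * ((1 + k) * (1 + k) * (1 + k))
             ≡ (1 + k) * ((1 + k) + 1) * ((1 + k) * ((1 + k) + 1))
  step = solve-∀

-- 12 S5 = 2K³ − K², stated without subtraction.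
S5-closed : ∀ k → 12 * S5 k + Kof k * Kof k ≡ 2 * (Kof k * Kof k * Kof k)
S5-closed zero    = refl
S5-closed (suc k) = +-cancelʳ-≡ (K * K) _ _ (begin
  12 * (S5 k + t) + K′ * K′ + K * K         ≡⟨ regroup (S5 k) t (K′ * K′) (K * K) ⟩
  (12 * S5 k + K * K) + (12 * t + K′ * K′)  ≡⟨ cong (_+ (12 * t + K′ * K′)) (S5-closed k) ⟩
  2 * (K * K * K) + (12 * t + K′ * K′)      ≡⟨ step k ⟩
  2 * (K′ * K′ * K′) + K * K                ∎)
  where
  open ≡-Reasoning
  K = Kof k
  K′ = Kof (suc k)
  t = suc k * suc k * suc k * suc k * suc k
  regroup : ∀ s t a b → 12 * (s + t) + a + b ≡ (12 * s + b) + (12 * t + a)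
  regroup = solve-∀
  step : ∀ k → 2 * (k * (k + 1) * (k * (k + 1)) * (k * (k + 1)))
                 + (12 * ((1 + k) * (1 + k) * (1 + k) * (1 + k) * (1 + k)) + (1 + k) * ((1 + k) + 1) * ((1 + k) * ((1 + k) + 1)))
             ≡ 2 * ((1 + k) * ((1 + k) + 1) * ((1 + k) * ((1 + k) + 1)) * ((1 + k) * ((1 + k) + 1))) + k * (k + 1) * (k * (k + 1))
  step = solve-∀

S5-bound : ∀ k → 12 * S5 k ≤ 2 * (Kof k * Kof k * Kof k)
S5-bound k = ≤-trans (m≤m+n (12 * S5 k) (Kof k * Kof k)) (≤-reflexive (S5-closed k))

sum-odd₃ : ∀ k a b → sumN k (λ i → a * i + b * (i * i * i)) ≡ a * S1 k + b * S3 k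
sum-odd₃ k a b = trans (sum-+ k (a *_) (λ i → b * (i * i * i)))
                       (cong₂ _+_ (sum-scale k a (λ i → i)) (sum-scale k b (λ i → i * i * i)))

sum-odd₅ : ∀ k a b c → sumN k (λ i → a * i + b * (i * i * i) + c * (i * i * i * i * i)) ≡ a * S1 k + b * S3 k + c * S5 k
sum-odd₅ k a b c = trans (sum-+ k (λ i → a * i + b * (i * i * i)) (λ i → c * (i * i * i * i * i)))
                         (cong₂ _+_ (sum-odd₃ k a b) (sum-scale k c (λ i → i * i * i * i * i)))

first-order : ∀ ℓ k w .{{_ : NonZero w}} → Balanced ℓ k w → ℓ * Kof k ≤ w
first-order ℓ k w balanced = *-cancelˡ-≤ X {{m^n≢0 w ℓ}} (begin
  X * (ℓ * Kof k)                   ≡⟨ cong (λ t → X * (ℓ * t)) (sym (S1-closed k)) ⟩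
  X * (ℓ * (2 * S1 k))              ≡⟨ regroup X ℓ (S1 k) ⟩
  2 * ℓ * X * S1 k                  ≡⟨ sym (sum-scale k (2 * ℓ * X) (λ i → i)) ⟩
  sumN k (λ i → 2 * ℓ * X * i)      ≤⟨ sum-mono k _ _ (λ i _ → ≤-trans (≤-reflexive (swap ℓ X i)) (U-first ℓ w i)) ⟩
  sumN k (λ i → w * U ℓ w i)        ≡⟨ sum-scale k w (U ℓ w) ⟩
  w * sumN k (U ℓ w)                ≡⟨ cong (w *_) balanced ⟩
  w * X                             ≡⟨ *-comm w X ⟩
  X * w                             ∎)
  where
  open ≤-Reasoning
  X = w ^ ℓ
  regroup : ∀ X l s → X * (l * (2 * s)) ≡ 2 * l * X * s
  regroup = solve-∀
  swap : ∀ l X i → 2 * l * X * i ≡ 2 * l * i * X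
  swap = solve-∀

ThirdOrder : ℕ → ℕ → ℕ → Set
ThirdOrder ℓ K w = 12 * ℓ * (w * w) * K + fall ℓ 3 * (K * K) ≤ 12 * (w * w * w)

third-order : ∀ ℓ k w .{{_ : NonZero w}} → Balanced ℓ k w → ThirdOrder ℓ (Kof k) w
third-order ℓ k w balanced = *-cancelˡ-≤ X {{m^n≢0 w ℓ}} (begin
  X * (12 * ℓ * (w * w) * Kof k + fall ℓ 3 * (Kof k * Kof k))
    ≡⟨ cong₂ (λ s t → X * (12 * ℓ * (w * w) * s + fall ℓ 3 * t)) (sym (S1-closed k)) (sym (S3-closed k)) ⟩
  X * (12 * ℓ * (w * w) * (2 * S1 k) + fall ℓ 3 * (4 * S3 k))
    ≡⟨ regroup X ℓ w (fall ℓ 3) (S1 k) (S3 k) ⟩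
  4 * (X * (a * S1 k + fall ℓ 3 * S3 k))
    ≡⟨ cong (4 *_) (sym (trans (sum-scale k X _) (cong (X *_) (sum-odd₃ k a (fall ℓ 3))))) ⟩
  4 * sumN k (λ i → X * (a * i + fall ℓ 3 * (i * i * i)))
    ≤⟨ *-monoʳ-≤ 4 (sum-mono k _ _ (λ i _ → U-third ℓ w i)) ⟩
  4 * sumN k (λ i → 3 * (w * w * w) * U ℓ w i)
    ≡⟨ cong (4 *_) (trans (sum-scale k (3 * (w * w * w)) (U ℓ w)) (cong (3 * (w * w * w) *_) balanced)) ⟩
  4 * (3 * (w * w * w) * X)
    ≡⟨ finish w X ⟩
  X * (12 * (w * w * w)) ∎)
  where
  open ≤-Reasoning
  X = w ^ ℓ
  a = 6 * ℓ * (w * w)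
  regroup : ∀ X l w f s1 s3 → X * (12 * l * (w * w) * (2 * s1) + f * (4 * s3)) ≡ 4 * (X * (6 * l * (w * w) * s1 + f * s3))
  regroup = solve-∀
  finish : ∀ w X → 4 * (3 * (w * w * w) * X) ≡ X * (12 * (w * w * w))
  finish = solve-∀

FifthOrder : ℕ → ℕ → ℕ → Set
FifthOrder ℓ K w = 600 * (w * w * w * w * w)
                 ≤ 600 * ℓ * (w * w * w * w) * K + 50 * fall ℓ 3 * (w * w) * (K * K) + fall ℓ 5 * (2 * (K * K * K))

-- Every i ≤ k lies in the range 2ℓi ≤ w of U-V-upper, because 2k ≤ k(k+1).
in-range : ∀ ℓ k w → ℓ * Kof k ≤ w → ∀ i → i ≤ k → 2 * ℓ * i ≤ w
in-range ℓ k w ℓK≤w i i≤k = begin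
  2 * ℓ * i      ≤⟨ *-monoʳ-≤ (2 * ℓ) i≤k ⟩
  2 * ℓ * k      ≡⟨ regroup ℓ k ⟩
  ℓ * (k * 2)    ≤⟨ *-monoʳ-≤ ℓ (2k≤K k) ⟩
  ℓ * Kof k      ≤⟨ ℓK≤w ⟩
  w              ∎
  where
  open ≤-Reasoning
  regroup : ∀ l k → 2 * l * k ≡ l * (k * 2)
  regroup = solve-∀
  2k≤K : ∀ k → k * 2 ≤ Kof k
  2k≤K zero    = z≤n
  2k≤K (suc j) = *-monoʳ-≤ (suc j) (s≤s (m≤n+m 1 j))

fifth-order : ∀ ℓ k w .{{_ : NonZero w}} → Balanced ℓ k w → ℓ * Kof k ≤ w → FifthOrder ℓ (Kof k) w
fifth-order ℓ k w balanced ℓK≤w = *-cancelˡ-≤ X {{m^n≢0 w ℓ}} (begin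
  X * (600 * w⁵)
    ≡⟨ regroup w⁵ X ⟩
  4 * (150 * w⁵ * X)
    ≡⟨ cong (λ t → 4 * (150 * w⁵ * t)) (sym balanced) ⟩
  4 * (150 * w⁵ * sumN k (U ℓ w))
    ≡⟨ cong (4 *_) (sym (sum-scale k (150 * w⁵) (U ℓ w))) ⟩
  4 * sumN k (λ i → 150 * w⁵ * U ℓ w i)
    ≤⟨ *-monoʳ-≤ 4 (sum-mono k _ _ (λ i i≤k → proj₁ (U-V-upper ℓ w i (in-range ℓ k w ℓK≤w i i≤k)))) ⟩
  4 * sumN k (λ i → X * U-majorant ℓ w i)
    ≡⟨ cong (4 *_) (trans (sum-scale k X (U-majorant ℓ w)) (cong (X *_) (sum-odd₅ k A B C))) ⟩
  4 * (X * (A * S1 k + B * S3 k + C * S5 k))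
    ≡⟨ distribute X ℓ w (fall ℓ 3) (fall ℓ 5) (S1 k) (S3 k) (S5 k) ⟩
  X * (600 * ℓ * w⁴ * (2 * S1 k) + 50 * fall ℓ 3 * (w * w) * (4 * S3 k) + fall ℓ 5 * (12 * S5 k))
    ≡⟨ cong₂ (λ s t → X * (600 * ℓ * w⁴ * s + 50 * fall ℓ 3 * (w * w) * t + fall ℓ 5 * (12 * S5 k))) (S1-closed k) (S3-closed k) ⟩
  X * (600 * ℓ * w⁴ * K + 50 * fall ℓ 3 * (w * w) * (K * K) + fall ℓ 5 * (12 * S5 k))
    ≤⟨ *-monoʳ-≤ X (+-monoʳ-≤ (600 * ℓ * w⁴ * K + 50 * fall ℓ 3 * (w * w) * (K * K)) (*-monoʳ-≤ (fall ℓ 5) (S5-bound k))) ⟩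
  X * (600 * ℓ * w⁴ * K + 50 * fall ℓ 3 * (w * w) * (K * K) + fall ℓ 5 * (2 * (K * K * K))) ∎)
  where
  open ≤-Reasoning
  X = w ^ ℓ
  K = Kof k
  w⁴ = w * w * w * w
  w⁵ = w * w * w * w * w
  A = 300 * ℓ * w⁴
  B = 50 * fall ℓ 3 * (w * w)
  C = 3 * fall ℓ 5
  regroup : ∀ a X → X * (600 * a) ≡ 4 * (150 * a * X)
  regroup = solve-∀
  distribute : ∀ X l w f g s1 s3 s5 →
               4 * (X * (300 * l * (w * w * w * w) * s1 + 50 * f * (w * w) * s3 + 3 * g * s5))
               ≡ X * (600 * l * (w * w * w * w) * (2 * s1) + 50 * f * (w * w) * (4 * s3) + g * (12 * s5))
  distribute = solve-∀

-- The summed estimates as constraints on the excess e = w − ℓK.  After scaling by 12ℓ, i.e. with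
-- M = 12ℓ·ℓK and E = 12ℓ·e, they become the polynomial inequalities handled by scaled-upper
-- and scaled-lower, in which p = δ ℓ = (ℓ−1)(ℓ−2) is the numerator of the correction term.
δ : ℕ → ℕ
δ ℓ = (ℓ ∸ 1) * (ℓ ∸ 2)

excess-dominates : ∀ M E p q → q ≤ p → p < E →
  600 * p * (M * M) * ((M + E) * (M + E)) + 288 * p * q * (M * M * M) + 600 * ((M + E) * (M + E) * (M + E) * (M + E))
    ≤ 600 * E * ((M + E) * (M + E) * (M + E) * (M + E))
excess-dominates M E p q q≤p p<E = begin
  T₁ + 288 * p * q * (M * M * M) + W⁴′
    ≤⟨ +-monoˡ-≤ W⁴′ (+-monoʳ-≤ T₁ cubic) ⟩
  T₁ + 1200 * p * M * E * W² + W⁴′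
    ≤⟨ +-monoˡ-≤ W⁴′ (m≤m+n (T₁ + 1200 * p * M * E * W²) (600 * p * (E * E) * W²)) ⟩
  T₁ + 1200 * p * M * E * W² + 600 * p * (E * E) * W² + W⁴′
    ≡⟨ binomial p M E ⟩
  600 * (1 + p) * W⁴
    ≤⟨ *-monoˡ-≤ W⁴ (*-monoʳ-≤ 600 p<E) ⟩
  600 * E * W⁴ ∎
  where
  open ≤-Reasoning
  W² = (M + E) * (M + E)
  W⁴ = (M + E) * (M + E) * (M + E) * (M + E)
  W⁴′ = 600 * W⁴
  T₁ = 600 * p * (M * M) * W²
  cubic : 288 * p * q * (M * M * M) ≤ 1200 * p * M * E * W²
  cubic = begin
    288 * p * q * (M * M * M)     ≤⟨ *-monoˡ-≤ (M * M * M) (*-mono-≤ (*-monoˡ-≤ p (m≤m+n 288 912)) q≤E) ⟩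
    1200 * p * E * (M * M * M)    ≡⟨ regroup p E M ⟩
    1200 * p * M * E * (M * M)    ≤⟨ *-monoʳ-≤ (1200 * p * M * E) (*-mono-≤ (m≤m+n M E) (m≤m+n M E)) ⟩
    1200 * p * M * E * W²         ∎
    where
    q≤E : q ≤ E
    q≤E = ≤-trans q≤p (<⇒≤ p<E)
    regroup : ∀ p E M → 1200 * p * E * (M * M * M) ≡ 1200 * p * M * E * (M * M)
    regroup = solve-∀
  binomial : ∀ p M E → 600 * p * (M * M) * ((M + E) * (M + E)) + 1200 * p * M * E * ((M + E) * (M + E))
                         + 600 * p * (E * E) * ((M + E) * (M + E)) + 600 * ((M + E) * (M + E) * (M + E) * (M + E))
                       ≡ 600 * (1 + p) * ((M + E) * (M + E) * (M + E) * (M + E))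
  binomial = solve-∀

scaled-upper : ∀ M E p q → q ≤ p →
  600 * ((M + E) * (M + E) * (M + E) * (M + E) * (M + E))
    ≤ 600 * M * ((M + E) * (M + E) * (M + E) * (M + E)) + 600 * p * (M * M) * ((M + E) * (M + E)) + 288 * p * q * (M * M * M) →
  E ≤ p
scaled-upper M E p q q≤p fifth with E ≤? p
... | yes E≤p = E≤p
... | no  E≰p = ⊥-elim (no-overshoot (≰⇒> E≰p))
  where
  W⁴ = (M + E) * (M + E) * (M + E) * (M + E)
  R = 600 * p * (M * M) * ((M + E) * (M + E)) + 288 * p * q * (M * M * M)
  EW⁴≤R : 600 * E * W⁴ ≤ R
  EW⁴≤R = +-cancelˡ-≤ (600 * M * W⁴) _ _ (begin
    600 * M * W⁴ + 600 * E * W⁴                     ≡⟨ split M E ⟩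
    600 * ((M + E) * (M + E) * (M + E) * (M + E) * (M + E)) ≤⟨ fifth ⟩
    600 * M * W⁴ + 600 * p * (M * M) * ((M + E) * (M + E)) + 288 * p * q * (M * M * M)
                                                    ≡⟨ +-assoc (600 * M * W⁴) _ _ ⟩
    600 * M * W⁴ + R                                ∎)
    where
    open ≤-Reasoning
    split : ∀ M E → 600 * M * ((M + E) * (M + E) * (M + E) * (M + E)) + 600 * E * ((M + E) * (M + E) * (M + E) * (M + E))
                    ≡ 600 * ((M + E) * (M + E) * (M + E) * (M + E) * (M + E))
    split = solve-∀
  -- E > p would make 600·W⁴ ≤ 0.
  no-overshoot : p < E → ⊥
  no-overshoot p<E = <⇒≱ W⁴-positive (+-cancelˡ-≤ R (600 * W⁴) 0 R+W⁴≤R)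
    where
    R+W⁴≤R : R + 600 * W⁴ ≤ R + 0
    R+W⁴≤R = ≤-trans (excess-dominates M E p q q≤p p<E) (≤-trans EW⁴≤R (≤-reflexive (sym (+-identityʳ R))))
    1≤W : 1 ≤ M + E
    1≤W = ≤-trans (s≤s z≤n) (≤-trans p<E (m≤n+m E M))
    W⁴-positive : 0 < 600 * W⁴
    W⁴-positive = *-mono-≤ {1} {600} (s≤s z≤n) (*-mono-≤ (*-mono-≤ (*-mono-≤ 1≤W 1≤W) 1≤W) 1≤W)

-- Scaled third-order inequality p M² ≤ E (M+E)², together with E ≤ p, gives M p ≤ M E + 2p²:
-- multiply the claim by (M+p)² and bound (M+E)² by (M+p)².
scaled-lower : ∀ M E p → 1 ≤ M → E ≤ p → p * (M * M) ≤ E * ((M + E) * (M + E)) → M * p ≤ M * E + 2 * (p * p)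
scaled-lower M@(suc _) E p _ E≤p third = *-cancelˡ-≤ Z (begin
  Z * (M * p)                                          ≤⟨ m≤m+n (Z * (M * p)) (3 * M * p * p * p + 2 * p * p * p * p) ⟩
  Z * (M * p) + (3 * M * p * p * p + 2 * p * p * p * p) ≡⟨ expand M p ⟩
  M * (p * (M * M)) + 2 * (p * p) * Z                  ≤⟨ +-monoˡ-≤ (2 * (p * p) * Z) (*-monoʳ-≤ M third) ⟩
  M * (E * ((M + E) * (M + E))) + 2 * (p * p) * Z      ≤⟨ +-monoˡ-≤ (2 * (p * p) * Z) (*-monoʳ-≤ M (*-monoʳ-≤ E (*-mono-≤ M+E≤M+p M+E≤M+p))) ⟩
  M * (E * Z) + 2 * (p * p) * Z                        ≡⟨ collect M E p ⟩
  Z * (M * E + 2 * (p * p))                            ∎)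
  where
  open ≤-Reasoning
  Z = (M + p) * (M + p)
  M+E≤M+p : M + E ≤ M + p
  M+E≤M+p = +-monoʳ-≤ M E≤p
  expand : ∀ M p → (M + p) * (M + p) * (M * p) + (3 * M * p * p * p + 2 * p * p * p * p)
                   ≡ M * (p * (M * M)) + 2 * (p * p) * ((M + p) * (M + p))
  expand = solve-∀
  collect : ∀ M E p → M * (E * ((M + p) * (M + p))) + 2 * (p * p) * ((M + p) * (M + p))
                      ≡ (M + p) * (M + p) * (M * E + 2 * (p * p))
  collect = solve-∀

-- Upper estimate for the excess:  FifthOrder at w = ℓK + e  ⇒  12ℓe ≤ δ ℓ.
-- Multiplying by (12ℓ)⁵ turns it into the scaled inequality, with q = (ℓ−3)(ℓ−4) ≤ δ ℓ.
excess-upper : ∀ ℓ K e → FifthOrder ℓ K (ℓ * K + e) → 12 * ℓ * e ≤ δ ℓ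
excess-upper ℓ K e fifth =
  scaled-upper (12 * ℓ * (ℓ * K)) (12 * ℓ * e) (δ ℓ) q q≤δ (begin
    600 * (W * W * W * W * W)                 ≡⟨ scale-left ℓ K e ⟩
    T⁵ * (600 * (w * w * w * w * w))          ≤⟨ *-monoʳ-≤ T⁵ fifth ⟩
    T⁵ * (600 * ℓ * (w * w * w * w) * K + 50 * fall ℓ 3 * (w * w) * (K * K) + fall ℓ 5 * (2 * (K * K * K)))
                                              ≡⟨ scale-right ℓ K e (ℓ ∸ 1) (ℓ ∸ 2) (ℓ ∸ 3) (ℓ ∸ 4) ⟩
    600 * M * (W * W * W * W) + 600 * δ ℓ * (M * M) * (W * W) + 288 * δ ℓ * q * (M * M * M) ∎)
  where
  open ≤-Reasoning
  w = ℓ * K + e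
  M = 12 * ℓ * (ℓ * K)
  W = M + 12 * ℓ * e
  T⁵ = (12 * ℓ) * (12 * ℓ) * (12 * ℓ) * (12 * ℓ) * (12 * ℓ)
  q = (ℓ ∸ 3) * (ℓ ∸ 4)
  q≤δ : q ≤ δ ℓ
  q≤δ = *-mono-≤ (∸-monoʳ-≤ ℓ (s≤s (z≤n {2}))) (∸-monoʳ-≤ ℓ (s≤s (s≤s (z≤n {2}))))
  scale-left : ∀ l K e →
    600 * ((12 * l * (l * K) + 12 * l * e) * (12 * l * (l * K) + 12 * l * e) * (12 * l * (l * K) + 12 * l * e)
           * (12 * l * (l * K) + 12 * l * e) * (12 * l * (l * K) + 12 * l * e))
    ≡ (12 * l) * (12 * l) * (12 * l) * (12 * l) * (12 * l) * (600 * ((l * K + e) * (l * K + e) * (l * K + e) * (l * K + e) * (l * K + e)))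
  scale-left = solve-∀
  scale-right : ∀ l K e a b c d →
    (12 * l) * (12 * l) * (12 * l) * (12 * l) * (12 * l)
      * (600 * l * ((l * K + e) * (l * K + e) * (l * K + e) * (l * K + e)) * K
         + 50 * (1 * l * a * b) * ((l * K + e) * (l * K + e)) * (K * K) + (1 * l * a * b * c * d) * (2 * (K * K * K)))
    ≡ 600 * (12 * l * (l * K)) * ((12 * l * (l * K) + 12 * l * e) * (12 * l * (l * K) + 12 * l * e)
                                  * (12 * l * (l * K) + 12 * l * e) * (12 * l * (l * K) + 12 * l * e))
      + 600 * (a * b) * ((12 * l * (l * K)) * (12 * l * (l * K))) * ((12 * l * (l * K) + 12 * l * e) * (12 * l * (l * K) + 12 * l * e))
      + 288 * (a * b) * (c * d) * ((12 * l * (l * K)) * (12 * l * (l * K)) * (12 * l * (l * K)))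
  scale-right = solve-∀

-- The third-order inequality reduces to δ ℓ·K² ≤ 12ℓ·12e·w², i.e. δ M² ≤ E (M+E)².
excess-lower : ∀ ℓ K e → 1 ≤ ℓ → 1 ≤ K → ThirdOrder ℓ K (ℓ * K + e) → 12 * ℓ * e ≤ δ ℓ →
  12 * ℓ * (ℓ * K) * δ ℓ ≤ 12 * ℓ * (ℓ * K) * (12 * ℓ * e) + 2 * (δ ℓ * δ ℓ)
excess-lower ℓ K e 1≤ℓ 1≤K third E≤δ = scaled-lower M E (δ ℓ) 1≤M E≤δ (begin
  δ ℓ * (M * M)                           ≡⟨ scale-left ℓ K (ℓ ∸ 1) (ℓ ∸ 2) ⟩
  144 * ℓ * ℓ * ℓ * (fall ℓ 3 * (K * K))  ≤⟨ *-monoʳ-≤ (144 * ℓ * ℓ * ℓ) third′ ⟩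
  144 * ℓ * ℓ * ℓ * (12 * e * (w * w))    ≡⟨ scale-right ℓ K e ⟩
  E * ((M + E) * (M + E))                 ∎)
  where
  open ≤-Reasoning
  w = ℓ * K + e
  M = 12 * ℓ * (ℓ * K)
  E = 12 * ℓ * e
  1≤M : 1 ≤ M
  1≤M = *-mono-≤ (*-mono-≤ {1} {12} (s≤s z≤n) 1≤ℓ) (*-mono-≤ 1≤ℓ 1≤K)
  third′ : fall ℓ 3 * (K * K) ≤ 12 * e * (w * w)
  third′ = +-cancelˡ-≤ (12 * ℓ * (w * w) * K) _ _ (≤-trans third (≤-reflexive (split ℓ K e)))
    where
    split : ∀ l K e → 12 * ((l * K + e) * (l * K + e) * (l * K + e))
                      ≡ 12 * l * ((l * K + e) * (l * K + e)) * K + 12 * e * ((l * K + e) * (l * K + e))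
    split = solve-∀
  scale-left : ∀ l K a b → a * b * (12 * l * (l * K) * (12 * l * (l * K))) ≡ 144 * l * l * l * ((1 * l * a * b) * (K * K))
  scale-left = solve-∀
  scale-right : ∀ l K e → 144 * l * l * l * (12 * e * ((l * K + e) * (l * K + e)))
                          ≡ 12 * l * e * ((12 * l * (l * K) + 12 * l * e) * (12 * l * (l * K) + 12 * l * e))
  scale-right = solve-∀

mixed-≤ : ∀ a n₁ d₁ b n₂ d₂ → (a * suc d₁ + n₁) * suc d₂ ≤ (b * suc d₂ + n₂) * suc d₁ →
          ι (+ a) ℚ.+ (+ n₁) ℚ./ suc d₁ ℚ.≤ ι (+ b) ℚ.+ (+ n₂) ℚ./ suc d₂
mixed-≤ a n₁ d₁ b n₂ d₂ h = ℚP.toℚᵘ-cancel-≤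
  (ℚᵘP.≤-respˡ-≃ (ℚᵘP.≃-sym (as-ℚᵘ a n₁ d₁)) (ℚᵘP.≤-respʳ-≃ (ℚᵘP.≃-sym (as-ℚᵘ b n₂ d₂))
    (ℚᵘ.*≤* (subst₂ ℤ._≤_ (sym (cross a d₁ n₁ d₂)) (sym (cross b d₂ n₂ d₁)) (ℤ.+≤+ h)))))
  where
  as-ℚᵘ : ∀ a n d → ℚ.toℚᵘ (ι (+ a) ℚ.+ (+ n) ℚ./ suc d) ℚᵘ.≃ (mkℚᵘ (+ a) 0 ℚᵘ.+ mkℚᵘ (+ n) d)
  as-ℚᵘ a n d = ℚᵘP.≃-trans (ℚP.toℚᵘ-homo-+ (ι (+ a)) ((+ n) ℚ./ suc d))
                  (ℚᵘP.+-cong (ℚP.toℚᵘ-fromℚᵘ (mkℚᵘ (+ a) 0)) (ℚP.toℚᵘ-fromℚᵘ (mkℚᵘ (+ n) d)))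
  cross : ∀ a d₁ n₁ d₂ → (+ a ℤ.* + suc d₁ ℤ.+ + n₁ ℤ.* + 1) ℤ.* + suc (d₂ + 0) ≡ + ((a * suc d₁ + n₁) * suc d₂)
  cross a d₁ n₁ d₂ rewrite +-identityʳ d₂ | ℤP.*-identityʳ (+ n₁) =
    trans (cong (ℤ._* + suc d₂) (trans (cong (ℤ._+ + n₁) (sym (ℤP.pos-* a (suc d₁)))) (sym (ℤP.pos-+ (a * suc d₁) n₁))))
          (sym (ℤP.pos-* (a * suc d₁ + n₁) (suc d₂)))

≤-+⇒-≤ : ∀ (x y z : ℚ) → x ℚ.≤ y ℚ.+ z → x ℚ.- z ℚ.≤ y
≤-+⇒-≤ x y z h = ℚP.≤-trans (ℚP.+-monoˡ-≤ (ℚ.- z) h)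
  (ℚP.≤-reflexive (trans (ℚP.+-assoc y z (ℚ.- z)) (trans (cong (y ℚ.+_) (ℚP.+-inverseʳ z)) (ℚP.+-identityʳ y))))

pos-∸ : ∀ a j → j ≤ a → + a ℤ.- + j ≡ + (a ∸ j)
pos-∸ a j j≤a = trans (ℤP.m-n≡m⊖n a j) (ℤP.⊖-≥ j≤a)

corr1-closed : ∀ m → corr1 (suc m) ≡ (+ δ (suc m)) ℚ./ (12 * suc m)
corr1-closed zero    = refl
corr1-closed (suc n) = cong (ℚ._/ (12 * suc (suc n)))
  (trans (cong₂ ℤ._*_ (pos-∸ (2 + n) 1 (s≤s z≤n)) (pos-∸ (2 + n) 2 (s≤s (s≤s z≤n)))) (sym (ℤP.pos-* (suc n) n)))

corr2-closed : ∀ m j → corr2 (suc m) (suc j) ≡ (+ (δ (suc m) * δ (suc m))) ℚ./ (72 * (suc m ^ 3) * (suc j * suc (suc j)))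
corr2-closed zero    j = refl
corr2-closed (suc n) j = cong (ℚ._/ (72 * (suc (suc n) ^ 3) * (suc j * suc (suc j))))
  (trans (cong₂ (λ s t → (s ℤ.^ 2) ℤ.* (t ℤ.^ 2)) (pos-∸ (2 + n) 1 (s≤s z≤n)) (pos-∸ (2 + n) 2 (s≤s (s≤s z≤n))))
  (trans (cong₂ ℤ._*_ (pos-^ (suc n) 2) (pos-^ n 2)) (trans (sym (ℤP.pos-* (suc n ^ 2) (n ^ 2))) (cong +_ (squares (suc n) n)))))
  where
  squares : ∀ a b → a * (a * 1) * (b * (b * 1)) ≡ a * b * (a * b)
  squares = solve-∀

upperBound-from-excess : ∀ m j e → 12 * suc m * e ≤ δ (suc m) →
  ι (+ (suc m * Kof (suc j) + e)) ℚ.≤ upperBound (suc m) (suc j)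
upperBound-from-excess m j e excess =
  subst₂ ℚ._≤_ (ℚP.+-identityʳ (ι (+ w))) (cong (ι (+ L) ℚ.+_) (sym (corr1-closed m)))
    (mixed-≤ w 0 0 L (δ ℓ) _ (begin
      (w * 1 + 0) * (12 * ℓ)    ≡⟨ expand ℓ (Kof (suc j)) e ⟩
      L * (12 * ℓ) + 12 * ℓ * e ≤⟨ +-monoʳ-≤ (L * (12 * ℓ)) excess ⟩
      L * (12 * ℓ) + δ ℓ        ≡⟨ sym (*-identityʳ _) ⟩
      (L * (12 * ℓ) + δ ℓ) * 1  ∎))
  where
  open ≤-Reasoning
  ℓ = suc m
  L = ℓ * Kof (suc j)
  w = L + e
  expand : ∀ l K e → ((l * K + e) * 1 + 0) * (12 * l) ≡ l * K * (12 * l) + 12 * l * e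
  expand = solve-∀

-- Cross-multiplied form of  ℓK + δ/(12ℓ) ≤ w + δ²/(72ℓ³K)  for w = ℓK + e, from the lower estimate.
lower-cross : ∀ ℓ K e → 12 * ℓ * (ℓ * K) * δ ℓ ≤ 12 * ℓ * (ℓ * K) * (12 * ℓ * e) + 2 * (δ ℓ * δ ℓ) →
  (ℓ * K * (12 * ℓ) + δ ℓ) * (72 * ℓ ^ 3 * K) ≤ ((ℓ * K + e) * (72 * ℓ ^ 3 * K) + δ ℓ * δ ℓ) * (12 * ℓ)
lower-cross ℓ K e excess = begin
  (ℓ * K * (12 * ℓ) + δ ℓ) * (72 * ℓ ^ 3 * K)                ≡⟨ expand ℓ K (δ ℓ) ⟩
  M * D + 6 * ℓ * (M * δ ℓ)                                   ≤⟨ +-monoʳ-≤ (M * D) (*-monoʳ-≤ (6 * ℓ) excess) ⟩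
  M * D + 6 * ℓ * (M * (12 * ℓ * e) + 2 * (δ ℓ * δ ℓ))        ≡⟨ collect ℓ K e (δ ℓ) ⟩
  ((ℓ * K + e) * (72 * ℓ ^ 3 * K) + δ ℓ * δ ℓ) * (12 * ℓ)    ∎
  where
  open ≤-Reasoning
  M = 12 * ℓ * (ℓ * K)
  D = 72 * ℓ ^ 3 * K
  expand : ∀ l K p → (l * K * (12 * l) + p) * (72 * (l * (l * (l * 1))) * K)
                     ≡ 12 * l * (l * K) * (72 * (l * (l * (l * 1))) * K) + 6 * l * (12 * l * (l * K) * p)
  expand = solve-∀
  collect : ∀ l K e p → 12 * l * (l * K) * (72 * (l * (l * (l * 1))) * K) + 6 * l * (12 * l * (l * K) * (12 * l * e) + 2 * (p * p))
                        ≡ ((l * K + e) * (72 * (l * (l * (l * 1))) * K) + p * p) * (12 * l)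
  collect = solve-∀

lowerBound-from-excess : ∀ m j e →
  12 * suc m * (suc m * Kof (suc j)) * δ (suc m) ≤ 12 * suc m * (suc m * Kof (suc j)) * (12 * suc m * e) + 2 * (δ (suc m) * δ (suc m)) →
  lowerBound (suc m) (suc j) ℚ.≤ ι (+ (suc m * Kof (suc j) + e))
lowerBound-from-excess m j e excess =
  ≤-+⇒-≤ (upperBound ℓ (suc j)) (ι (+ w)) (corr2 ℓ (suc j))
    (subst₂ ℚ._≤_ (cong (ι (+ L) ℚ.+_) (sym (corr1-closed m))) (cong (ι (+ w) ℚ.+_) (sym (corr2-closed m j)))
      (mixed-≤ L (δ ℓ) _ w (δ ℓ * δ ℓ) _ (subst Cross K≡ (lower-cross ℓ (Kof (suc j)) e excess))))
  where
  ℓ = suc m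
  L = ℓ * Kof (suc j)
  w = L + e
  K≡ : Kof (suc j) ≡ suc j * suc (suc j)
  K≡ = cong (suc j *_) (+-comm (suc j) 1)
  Cross : ℕ → Set
  Cross K = (L * (12 * ℓ) + δ ℓ) * (72 * ℓ ^ 3 * K) ≤ (w * (72 * ℓ ^ 3 * K) + δ ℓ * δ ℓ) * (12 * ℓ)

mainTheorem4 : (ℓ k w : ℕ) → 1 ≤ ℓ → 1 ≤ k → 1 ≤ w →
    (+ w) ℤ.^ ℓ ≡ diffSum ℓ k w →
    (lowerBound ℓ k ℚ.≤ ι (+ w)) × (ι (+ w) ℚ.≤ upperBound ℓ k)
mainTheorem4 ℓ@(suc m) k@(suc j) w@(suc _) 1≤ℓ _ _ hyp =
  subst Bounds w-split (lowerBound-from-excess m j e lower , upperBound-from-excess m j e upper)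
  where
  K = Kof k
  balanced : Balanced ℓ k w
  balanced = balanced-from-ℤ ℓ k w hyp
  ℓK≤w : ℓ * K ≤ w
  ℓK≤w = first-order ℓ k w balanced
  e = w ∸ ℓ * K
  w-split : ℓ * K + e ≡ w
  w-split = m+[n∸m]≡n ℓK≤w
  upper : 12 * ℓ * e ≤ δ ℓ
  upper = excess-upper ℓ K e (subst (FifthOrder ℓ K) (sym w-split) (fifth-order ℓ k w balanced ℓK≤w))
  lower : 12 * ℓ * (ℓ * K) * δ ℓ ≤ 12 * ℓ * (ℓ * K) * (12 * ℓ * e) + 2 * (δ ℓ * δ ℓ)
  lower = excess-lower ℓ K e 1≤ℓ (s≤s z≤n) (subst (ThirdOrder ℓ K) (sym w-split) (third-order ℓ k w balanced)) upper
  Bounds : ℕ → Set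
  Bounds z = (lowerBound ℓ k ℚ.≤ ι (+ z)) × (ι (+ z) ℚ.≤ upperBound ℓ k)
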